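{- Let $k\geq 2$, $t\geq 0$, and $n\geq k^2+tk(k-1)$ be integers such that $k^2+tk(k-1)$ divides $n$. If there exists a $(k^2+tk(k-1),k,1)$-RBIBD, then there is a coloring of the edges of the complete graph $K_n$ with $(t+1)k+1$ colors such that every monochromatic component has at most $\frac{n}{(t+1)k-t}$ vertices. In particular (case $t=0$), if there exists an affine plane of order $k$ and $k^2$ divides $n$, then there is a coloring of the edges of $K_n$ with $k+1$ colors such that every monochromatic component has at most $\frac{n}{k}$ vertices.
   Context: A $(v,k,1)$-resolvable balanced incomplete block design ($(v,k,1)$-RBIBD) is a $k$-uniform hypergraph on $v$ vertices such that each pair of distinct vertices is contained in exactly one edge and the edge set can be partitioned into $\frac{v-1}{k-1}$ perfect matchings. An affine plane of order $k$ is a $k$-uniform hypergraph on $k^2$ vertices with $k(k+1)$ edges such that each pair of distinct vertices is contained in exactly one edge (equivalently, a $(k^2,k,1)$-RBIBD). A monochromatic component is a maximal connected subgraph of the subgraph formed by the edges of one color. -}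

module Defs where

open import Data.Nat using (ℕ; suc; _*_; _∸_; _≤_)
open import Data.Fin using (Fin)
open import Data.Fin.Subset using (Subset; _∈_; ∣_∣)
open import Data.Product using (Σ; ∃; _×_)
open import Data.List using (List; length)
open import Data.List.Relation.Unary.All using (All)
open import Data.List.Relation.Unary.Unique.Propositional using (Unique)
open import Relation.Binary.PropositionalEquality using (_≡_; _≢_)

∃! : {A : Set} → (A → Set) → Set
∃! {A} P = Σ A λ a → P a × (∀ b → P b → b ≡ a)

-- The edge set is { block i b | i : Fin r, b : Fin m }, where class i
-- (the blocks block i b, b : Fin m) is a perfect matching, and the r
-- classes partition the edge set; r = (v-1)/(k-1).
record RBIBD (v k : ℕ) : Set where
  field
    r : ℕ
    r-spec : r * (k ∸ 1) ≡ v ∸ 1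
    m : ℕ
    block : Fin r → Fin m → Subset v
    uniform : ∀ i b → ∣ block i b ∣ ≡ k
    matching : ∀ i (x : Fin v) → ∃! λ b → x ∈ block i b
    pairs : ∀ (x y : Fin v) → x ≢ y →
            ∃! λ (ib : Fin r × Fin m) →
              x ∈ block (Data.Product.proj₁ ib) (Data.Product.proj₂ ib)
              × y ∈ block (Data.Product.proj₁ ib) (Data.Product.proj₂ ib)

-- An edge colouring of the complete graph K_n with c colours:
-- a colour for each unordered pair {x,y}, x ≢ y (values on the diagonal irrelevant).
record EdgeColouring (n c : ℕ) : Set where
  field
    col : Fin n → Fin n → Fin c
    sym : ∀ x y → col x y ≡ col y x

data Reach {n c : ℕ} (χ : EdgeColouring n c) (a : Fin c) (x : Fin n) : Fin n → Set where
  here : Reach χ a x x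
  step : ∀ {y z} → Reach χ a x y → y ≢ z → EdgeColouring.col χ y z ≡ a → Reach χ a x z

-- Every monochromatic component has at most n/d vertices, i.e. (size)·d ≤ n:
-- any list of distinct vertices in a common colour-a component has length·d ≤ n.
ComponentsBounded : ∀ {n c} → EdgeColouring n c → (d : ℕ) → Set
ComponentsBounded {n} {c} χ d =
  ∀ (a : Fin c) (x : Fin n) (ys : List (Fin n)) →
    Unique ys → All (Reach χ a x) ys → length ys * d ≤ n

-- Blow up every point of the design into q = n / v copies and colour an edge by the
-- parallel class containing the pair of points below its ends (an arbitrary fixed class
-- when both ends lie over the same point). A monochromatic path of colour a never leaves
-- the copies of the block of class a where it starts, so every component has at most
-- k q vertices; and k ((t + 1) k − t) = v, i.e. k q = n / ((t + 1) k − t). The design has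
-- (v − 1)/(k − 1) = (t + 1) k + 1 parallel classes, which is the number of colours.
module Submission where

open import Defs
open import Data.Nat using (ℕ; suc; _+_; _*_; _∸_; _≤_; z≤n; s≤s)
open import Data.Nat.Divisibility using (_∣_; divides)
import Data.Nat.Properties as ℕ
open import Data.Nat.Tactic.RingSolver using (solve-∀)
open import Data.Fin using (Fin; zero; suc; remQuot; combine; _≟_)
open import Data.Fin.Properties using (combine-remQuot)
open import Data.Fin.Subset using (Subset; inside; outside; ⊤; ∣_∣) renaming (_∈_ to _∈ₛ_)
open import Data.Fin.Subset.Properties using (∣⊤∣≡n; ∈⊤)
open import Data.Vec using (_∷_; []; there)
open import Data.List using (List; []; _∷_; length; map)
open import Data.List.Properties using (length-map)
open import Data.List.Relation.Unary.All as All using (All; []; _∷_)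
open import Data.List.Relation.Unary.All.Properties using (map⁺)
open import Data.List.Relation.Unary.AllPairs using ([]; _∷_)
open import Data.List.Relation.Unary.Unique.Propositional using (Unique)
import Data.List.Relation.Unary.Unique.Propositional.Properties as Unique
open import Data.Product using (∃; _×_; _,_; proj₁; proj₂; uncurry)
open import Data.Unit using (tt) renaming (⊤ to Unit)
open import Data.Empty using (⊥-elim)
open import Function using (_∘_)
open import Relation.Nullary using (yes; no)
open import Relation.Binary.PropositionalEquality

module Counting {B : Set} where

  fibre₀ : ∀ {v} → List (B × Fin (suc v)) → List B
  fibre₀ [] = []
  fibre₀ ((b , zero) ∷ ys) = b ∷ fibre₀ ys
  fibre₀ ((_ , suc _) ∷ ys) = fibre₀ ys

  shiftDown : ∀ {v} → List (B × Fin (suc v)) → List (B × Fin v)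
  shiftDown [] = []
  shiftDown ((_ , zero) ∷ ys) = shiftDown ys
  shiftDown ((b , suc i) ∷ ys) = (b , i) ∷ shiftDown ys

  length-fibre₀-shiftDown : ∀ {v} (ys : List (B × Fin (suc v))) →
                            length ys ≡ length (fibre₀ ys) + length (shiftDown ys)
  length-fibre₀-shiftDown [] = refl
  length-fibre₀-shiftDown ((_ , zero) ∷ ys) = cong suc (length-fibre₀-shiftDown ys)
  length-fibre₀-shiftDown ((_ , suc _) ∷ ys) =
    trans (cong suc (length-fibre₀-shiftDown ys)) (sym (ℕ.+-suc _ _))

  fibre₀-All≢ : ∀ {v b} (ys : List (B × Fin (suc v))) →
                All ((b , zero) ≢_) ys → All (b ≢_) (fibre₀ ys)
  fibre₀-All≢ [] [] = []
  fibre₀-All≢ ((_ , zero) ∷ ys) (p ∷ ps) = (p ∘ cong (_, zero)) ∷ fibre₀-All≢ ys ps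
  fibre₀-All≢ ((_ , suc _) ∷ ys) (_ ∷ ps) = fibre₀-All≢ ys ps

  shiftDown-All≢ : ∀ {v b} {i : Fin v} (ys : List (B × Fin (suc v))) →
                   All ((b , suc i) ≢_) ys → All ((b , i) ≢_) (shiftDown ys)
  shiftDown-All≢ [] [] = []
  shiftDown-All≢ ((_ , zero) ∷ ys) (_ ∷ ps) = shiftDown-All≢ ys ps
  shiftDown-All≢ ((_ , suc _) ∷ ys) (p ∷ ps) =
    (p ∘ cong (λ (c , j) → c , suc j)) ∷ shiftDown-All≢ ys ps

  fibre₀-unique : ∀ {v} (ys : List (B × Fin (suc v))) → Unique ys → Unique (fibre₀ ys)
  fibre₀-unique [] [] = []
  fibre₀-unique ((_ , zero) ∷ ys) (p ∷ u) = fibre₀-All≢ ys p ∷ fibre₀-unique ys u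
  fibre₀-unique ((_ , suc _) ∷ ys) (_ ∷ u) = fibre₀-unique ys u

  shiftDown-unique : ∀ {v} (ys : List (B × Fin (suc v))) → Unique ys → Unique (shiftDown ys)
  shiftDown-unique [] [] = []
  shiftDown-unique ((_ , zero) ∷ ys) (_ ∷ u) = shiftDown-unique ys u
  shiftDown-unique ((_ , suc _) ∷ ys) (p ∷ u) = shiftDown-All≢ ys p ∷ shiftDown-unique ys u

  shiftDown-All∈ : ∀ {v s} {S : Subset v} (ys : List (B × Fin (suc v))) →
                   All ((_∈ₛ s ∷ S) ∘ proj₂) ys → All ((_∈ₛ S) ∘ proj₂) (shiftDown ys)
  shiftDown-All∈ [] [] = []
  shiftDown-All∈ ((_ , zero) ∷ ys) (_ ∷ ps) = shiftDown-All∈ ys ps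
  shiftDown-All∈ ((_ , suc _) ∷ ys) (there p ∷ ps) = p ∷ shiftDown-All∈ ys ps

  fibre₀-outside : ∀ {v} {S : Subset v} (ys : List (B × Fin (suc v))) →
                   All ((_∈ₛ outside ∷ S) ∘ proj₂) ys → fibre₀ ys ≡ []
  fibre₀-outside [] [] = refl
  fibre₀-outside ((_ , zero) ∷ ys) (() ∷ _)
  fibre₀-outside ((_ , suc _) ∷ ys) (_ ∷ ps) = fibre₀-outside ys ps

  unique-length≤∣S∣*m : (m : ℕ) → (∀ (bs : List B) → Unique bs → length bs ≤ m) →
                        ∀ {v} (S : Subset v) (ys : List (B × Fin v)) →
                        Unique ys → All ((_∈ₛ S) ∘ proj₂) ys → length ys ≤ ∣ S ∣ * m
  unique-length≤∣S∣*m m bound [] [] _ _ = z≤n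
  unique-length≤∣S∣*m m bound [] ((_ , ()) ∷ _) _ _
  unique-length≤∣S∣*m m bound (inside ∷ S) ys u a = begin
    length ys                                   ≡⟨ length-fibre₀-shiftDown ys ⟩
    length (fibre₀ ys) + length (shiftDown ys)  ≤⟨ ℕ.+-mono-≤ (bound (fibre₀ ys) (fibre₀-unique ys u))
                                                     (unique-length≤∣S∣*m m bound S (shiftDown ys)
                                                       (shiftDown-unique ys u) (shiftDown-All∈ ys a)) ⟩
    m + ∣ S ∣ * m                               ∎
    where open ℕ.≤-Reasoning
  unique-length≤∣S∣*m m bound (outside ∷ S) ys u a = begin
    length ys                                   ≡⟨ length-fibre₀-shiftDown ys ⟩
    length (fibre₀ ys) + length (shiftDown ys)  ≡⟨ cong ((_+ length (shiftDown ys)) ∘ length)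
                                                     (fibre₀-outside ys a) ⟩
    length (shiftDown ys)                       ≤⟨ unique-length≤∣S∣*m m bound S (shiftDown ys)
                                                     (shiftDown-unique ys u) (shiftDown-All∈ ys a) ⟩
    ∣ S ∣ * m                                   ∎
    where open ℕ.≤-Reasoning

open Counting using (unique-length≤∣S∣*m)

unique-Unit-length≤1 : (zs : List Unit) → Unique zs → length zs ≤ 1
unique-Unit-length≤1 [] _ = z≤n
unique-Unit-length≤1 (_ ∷ []) _ = s≤s z≤n
unique-Unit-length≤1 (tt ∷ tt ∷ _) ((p ∷ _) ∷ _) = ⊥-elim (p refl)

unique-Fin-length≤ : ∀ {q} (zs : List (Fin q)) → Unique zs → length zs ≤ q
unique-Fin-length≤ {q} zs u =
  subst₂ _≤_ (length-map _ zs) (trans (cong (_* 1) (∣⊤∣≡n q)) (ℕ.*-identityʳ q))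
    (unique-length≤∣S∣*m 1 unique-Unit-length≤1 ⊤ (map (tt ,_) zs)
      (Unique.map⁺ (cong proj₂) u) (map⁺ (All.tabulate (λ _ → ∈⊤))))

module ParallelClasses {v k : ℕ} (D : RBIBD v k) (loopClass : Fin (RBIBD.r D)) where
  open RBIBD D

  pairClass : Fin v → Fin v → Fin r
  pairClass u w with u ≟ w
  ... | yes _ = loopClass
  ... | no u≢w = proj₁ (proj₁ (pairs u w u≢w))

  pairClass-sym : ∀ u w → pairClass u w ≡ pairClass w u
  pairClass-sym u w with u ≟ w | w ≟ u
  ... | yes _   | yes _   = refl
  ... | yes u≡w | no w≢u  = ⊥-elim (w≢u (sym u≡w))
  ... | no u≢w  | yes w≡u = ⊥-elim (u≢w (sym w≡u))
  ... | no u≢w  | no w≢u  with pairs w u w≢u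
  ... | (ib , (w∈ , u∈) , _) = sym (cong proj₁ (proj₂ (proj₂ (pairs u w u≢w)) ib (u∈ , w∈)))

  blockThrough : Fin r → Fin v → Fin m
  blockThrough a u = proj₁ (matching a u)

  ∈-blockThrough : ∀ a u → u ∈ₛ block a (blockThrough a u)
  ∈-blockThrough a u = proj₁ (proj₂ (matching a u))

  blockThrough-unique : ∀ {a u b} → u ∈ₛ block a b → b ≡ blockThrough a u
  blockThrough-unique {a} {u} {b} u∈ = proj₂ (proj₂ (matching a u)) b u∈

  pairClass-closed : ∀ {a b u w} → u ∈ₛ block a b → pairClass u w ≡ a → w ∈ₛ block a b
  pairClass-closed {u = u} {w} u∈ _ with u ≟ w
  ... | yes refl = u∈
  pairClass-closed {u = u} {w} u∈ refl | no u≢w with pairs u w u≢w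
  ... | ((i , b′) , (u∈′ , w∈′) , _) =
    subst (λ c → w ∈ₛ block i c) (trans (blockThrough-unique u∈′) (sym (blockThrough-unique u∈))) w∈′

remQuot-injective : ∀ {q} v {x y : Fin (q * v)} → remQuot {q} v x ≡ remQuot v y → x ≡ y
remQuot-injective {q} v {x} {y} eq = begin
  x                                  ≡⟨ combine-remQuot {q} v x ⟨
  uncurry combine (remQuot {q} v x)  ≡⟨ cong (uncurry combine) eq ⟩
  uncurry combine (remQuot {q} v y)  ≡⟨ combine-remQuot {q} v y ⟩
  y                                  ∎
  where open ≡-Reasoning

module Blowup {v k : ℕ} (q : ℕ) (D : RBIBD v k) (loopClass : Fin (RBIBD.r D)) where
  open RBIBD D
  open ParallelClasses D loopClass

  project : Fin (q * v) → Fin v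
  project = proj₂ ∘ remQuot {q} v

  colouring : EdgeColouring (q * v) r
  colouring = record
    { col = λ x y → pairClass (project x) (project y)
    ; sym = λ x y → pairClass-sym (project x) (project y)
    }

  reach⇒∈blockThrough : ∀ {a x y} → Reach colouring a x y →
                        project y ∈ₛ block a (blockThrough a (project x))
  reach⇒∈blockThrough {a} {x} here = ∈-blockThrough a (project x)
  reach⇒∈blockThrough (step x⇝y _ colour≡a) = pairClass-closed (reach⇒∈blockThrough x⇝y) colour≡a

  component-length≤ : ∀ {a x} (ys : List (Fin (q * v))) →
                      Unique ys → All (Reach colouring a x) ys → length ys ≤ k * q
  component-length≤ {a} {x} ys u reaches =
    subst₂ _≤_ (length-map _ ys) (cong (_* q) (uniform a _))
      (unique-length≤∣S∣*m q unique-Fin-length≤ (block a (blockThrough a (project x)))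
        (map (remQuot v) ys) (Unique.map⁺ (remQuot-injective v) u)
        (map⁺ (All.map reach⇒∈blockThrough reaches)))

  componentsBounded : ∀ d → k * d ≡ v → ComponentsBounded colouring d
  componentsBounded d k*d≡v a x ys u reaches = begin
    length ys * d  ≤⟨ ℕ.*-monoˡ-≤ d (component-length≤ ys u reaches) ⟩
    k * q * d      ≡⟨ rearrange k q d ⟩
    q * (k * d)    ≡⟨ cong (q *_) k*d≡v ⟩
    q * v          ∎
    where
    open ℕ.≤-Reasoning
    rearrange : ∀ k q d → k * q * d ≡ q * (k * d)
    rearrange = solve-∀

blowup-colouring : ∀ {v k c} q (D : RBIBD v k) → RBIBD.r D ≡ suc c →
                   ∀ d → k * d ≡ v → ∃ λ (χ : EdgeColouring (q * v) (suc c)) → ComponentsBounded χ d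
blowup-colouring q D r≡1+c d k*d≡v =
  subst (λ c → ∃ λ (χ : EdgeColouring _ c) → ComponentsBounded χ d) r≡1+c
    (colouring , componentsBounded d k*d≡v)
  where open Blowup q D (subst Fin (sym r≡1+c) zero)

-- The right-hand side is (k * k + t * k * (k ∸ 1)) ∸ 1 for k = 2 + j, unfolded so that
-- the ring solver accepts the identity.
classes*[k∸1]≡design-size∸1 : ∀ j t → suc (suc t * suc (suc j)) * suc j
                                    ≡ suc j + suc j * suc (suc j) + t * suc (suc j) * suc j
classes*[k∸1]≡design-size∸1 = solve-∀

parallelClassCount : ∀ j t → let k = suc (suc j) in
                     (D : RBIBD (k * k + t * k * (k ∸ 1)) k) → RBIBD.r D ≡ suc (suc t * k)
parallelClassCount j t D = ℕ.*-cancelʳ-≡ (RBIBD.r D) _ (suc j)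
  (trans (RBIBD.r-spec D) (sym (classes*[k∸1]≡design-size∸1 j t)))

k*[[1+t]k∸t]≡design-size : ∀ j t → let k = suc j in k * (suc t * k ∸ t) ≡ k * k + t * k * (k ∸ 1)
k*[[1+t]k∸t]≡design-size j t = begin
  suc j * (suc t * suc j ∸ t)      ≡⟨ cong ((suc j *_) ∘ (_∸ t)) (split j t) ⟩
  suc j * (suc j + t * j + t ∸ t)  ≡⟨ cong (suc j *_) (ℕ.m+n∸n≡m (suc j + t * j) t) ⟩
  suc j * (suc j + t * j)          ≡⟨ expand j t ⟩
  suc j * suc j + t * suc j * j    ∎
  where
  open ≡-Reasoning
  split : ∀ j t → suc t * suc j ≡ suc j + t * j + t
  split = solve-∀
  expand : ∀ j t → suc j * (suc j + t * j) ≡ suc j * suc j + t * suc j * j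
  expand = solve-∀

fact4p2 : (k t n : ℕ) → 2 ≤ k →
    k * k + t * k * (k ∸ 1) ≤ n →
    (k * k + t * k * (k ∸ 1)) ∣ n →
    RBIBD (k * k + t * k * (k ∸ 1)) k →
    ∃ λ (χ : EdgeColouring n (suc (suc t * k))) →
    ComponentsBounded χ (suc t * k ∸ t)
fact4p2 k@(suc (suc j)) t n (s≤s (s≤s _)) _ (divides q refl) D =
  blowup-colouring q D (parallelClassCount j t D) (suc t * k ∸ t) (k*[[1+t]k∸t]≡design-size (suc j) t)
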